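{- Let $f:B^n\to B$ and let $\mathbf{x}$ be a transient vector. If $P$ is a directed path in $D_f(\mathbf{x})$ from $\alpha(\mathbf{x})$ to $\mathbf{x}$, then $W(P)$ is a walk in $C_f$ and $c_P=c_{W(P)}$. If $W=w^1,\ldots,w^r$ is a walk in $C_f$ and $\mathbf{x}=w^1\circ\cdots\circ w^r$, then $P(W)$ is a directed path in $D_f(\mathbf{x})$ from $\alpha(\mathbf{x})$ to $\mathbf{x}$ and $c_W=c_{P(W)}$. Moreover, $P(W(P))=P$ for every such path $P$ in $D_f(\mathbf{x})$, and $W(P(W))=W$ for every walk $W$ in $C_f$.
   Context: $B=\{0,1\}$. A transient is a nonempty word $t_1\cdots t_m$ over $B$ in which consecutive letters differ; $\alpha$, $\omega$ give its first and last letters. The contraction of a nonempty binary word deletes every letter equal to the letter immediately preceding it; for transients $\mathbf{s},\mathbf{t}$, $\mathbf{s}\circ\mathbf{t}$ is the contraction of the concatenation $\mathbf{s}\mathbf{t}$. A transient vector is an $n$-tuple of transients; $\alpha,\omega$ and $\circ$ are applied componentwise, and a binary vector $w\in B^n$ is regarded as the transient vector whose components have length 1. $D_f(\mathbf{x})$: vertices are the prefixes of $\mathbf{x}$ (vectors of nonempty prefixes of the components); arcs go from $\mathbf{u}$ to $\mathbf{v}$ when $\mathbf{v}$ arises from $\mathbf{u}$ by appending one letter to exactly one component; $\lambda(\mathbf{v})=f(\omega(\mathbf{v}))$. For a path $P=\mathbf{v}^1,\ldots,\mathbf{v}^r$, $c_P$ is the number of $i\in\{1,\ldots,r-1\}$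 with $\lambda(\mathbf{v}^i)=\lambda(\mathbf{v}^{i+1})$. $C_f$: the boolean $n$-cube with vertex set $B^n$, two vertices adjacent iff they differ in exactly one coordinate, vertex $v$ labelled $f(v)$. A walk $W=w^1,\ldots,w^r$ is a sequence of vertices with consecutive ones adjacent; $c_W$ is the number of $j\in\{1,\ldots,r-1\}$ with $f(w^j)=f(w^{j+1})$. For a path $P=\mathbf{v}^1,\ldots,\mathbf{v}^r$ in $D_f(\mathbf{x})$, $W(P)=\omega(\mathbf{v}^1),\ldots,\omega(\mathbf{v}^r)$. For a walk $W=w^1,\ldots,w^r$ in $C_f$, $P(W)=w^1,\ w^1\circ w^2,\ \ldots,\ w^1\circ\cdots\circ w^r$. -}

module Defs where

open import Data.Bool using (Bool; true; false; if_then_else_)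
open import Data.Bool.Properties using () renaming (_≟_ to _≟B_)
open import Data.Nat using (ℕ; zero; suc; _+_)
open import Data.Fin using (Fin)
open import Data.List using (List; []; _∷_)
open import Data.List.NonEmpty using (List⁺; _∷_; [_]; _∷⁺_; _⁺++⁺_; _⁺∷ʳ_; toList; head)
import Data.List.NonEmpty as L⁺
open import Data.List.Relation.Unary.Linked using (Linked)
import Data.List.Relation.Unary.All as LAll
open import Data.List.Relation.Binary.Prefix.Heterogeneous using (Prefix)
open import Data.Vec using (Vec; lookup; zipWith; updateAt)
import Data.Vec as V
open import Data.Vec.Relation.Unary.All using (All)
open import Data.Vec.Relation.Binary.Pointwise.Inductive using (Pointwise)
open import Data.Product using (Σ; ∃; ∃₂; _×_; _,_)
open import Relation.Binary.PropositionalEquality using (_≡_; _≢_)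
open import Relation.Nullary using (yes; no)

-- B = {0,1} is Bool.  A (binary) word is a nonempty list of bits.
Word : Set
Word = List⁺ Bool

IsTransient : Word → Set
IsTransient t = Linked _≢_ (toList t)

α : Word → Bool
α = head

lastFrom : {A : Set} → A → List A → A
lastFrom a []       = a
lastFrom a (b ∷ bs) = lastFrom b bs

ω : Word → Bool
ω (a ∷ as) = lastFrom a as

-- contraction: delete every letter equal to the letter immediately
-- preceding it (in the original word).  `keep p w` processes w, where p is
-- the letter immediately preceding w in the original word.
keep : Bool → List Bool → List Bool
keep p []       = []
keep p (b ∷ bs) with b ≟B p
... | yes _ = keep b bs
... | no  _ = b ∷ keep b bs

contraction : Word → Word
contraction (a ∷ as) = a ∷ keep a as

_∘T_ : Word → Word → Word
s ∘T t = contraction (s ⁺++⁺ t)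

TVec : ℕ → Set
TVec n = Vec Word n

BVec : ℕ → Set
BVec n = Vec Bool n

IsTransientVec : ∀ {n} → TVec n → Set
IsTransientVec x = All IsTransient x

αV : ∀ {n} → TVec n → BVec n
αV = V.map α

ωV : ∀ {n} → TVec n → BVec n
ωV = V.map ω

_∘V_ : ∀ {n} → TVec n → TVec n → TVec n
_∘V_ = zipWith _∘T_

embed : ∀ {n} → BVec n → TVec n
embed = V.map [_]

IsPrefixV : ∀ {n} → TVec n → TVec n → Set
IsPrefixV u x = Pointwise (λ s t → Prefix _≡_ (toList s) (toList t)) u x

Arc : ∀ {n} → TVec n → TVec n → Set
Arc {n} u v = Σ (Fin n) λ i → Σ Bool λ b → v ≡ updateAt u i (λ s → s ⁺∷ʳ b)

Consec : {A : Set} → (A → A → Set) → List⁺ A → Set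
Consec R p = Linked R (toList p)

lastᴸ : {A : Set} → List⁺ A → A
lastᴸ (a ∷ as) = lastFrom a as

IsPathD : ∀ {n} → TVec n → List⁺ (TVec n) → Set
IsPathD x P = LAll.All (λ v → IsPrefixV v x) (toList P) × Consec Arc P

IsPathFromTo : ∀ {n} → TVec n → List⁺ (TVec n) → Set
IsPathFromTo x P = IsPathD x P × head P ≡ embed (αV x) × lastᴸ P ≡ x

sameFrom : {A : Set} → (A → Bool) → A → List A → ℕ
sameFrom g a []       = 0
sameFrom g a (b ∷ bs) with g a ≟B g b
... | yes _ = suc (sameFrom g b bs)
... | no  _ = sameFrom g b bs

sameCount : {A : Set} → (A → Bool) → List⁺ A → ℕ
sameCount g (a ∷ as) = sameFrom g a as

labelD : ∀ {n} → (BVec n → Bool) → TVec n → Bool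
labelD f v = f (ωV v)

cP : ∀ {n} → (BVec n → Bool) → List⁺ (TVec n) → ℕ
cP f P = sameCount (labelD f) P

Adjacent : ∀ {n} → BVec n → BVec n → Set
Adjacent {n} u v = Σ (Fin n) λ i →
  lookup u i ≢ lookup v i × (∀ j → j ≢ i → lookup u j ≡ lookup v j)

IsWalk : ∀ {n} → List⁺ (BVec n) → Set
IsWalk W = Consec Adjacent W

cW : ∀ {n} → (BVec n → Bool) → List⁺ (BVec n) → ℕ
cW f W = sameCount f W

Wof : ∀ {n} → List⁺ (TVec n) → List⁺ (BVec n)
Wof = L⁺.map ωV

-- P(W) = w¹, w¹∘w², …, w¹∘⋯∘wʳ
scanComp : ∀ {n} → TVec n → List (BVec n) → List⁺ (TVec n)
scanComp acc []       = [ acc ]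
scanComp acc (w ∷ ws) = acc ∷⁺ scanComp (acc ∘V embed w) ws

Pof : ∀ {n} → List⁺ (BVec n) → List⁺ (TVec n)
Pof (w ∷ ws) = scanComp (embed w) ws

compose : ∀ {n} → List⁺ (BVec n) → TVec n
compose W = L⁺.foldl₁ _∘V_ (L⁺.map embed W)

module Submission where

-- Contracting a transient s with a single letter b either leaves s unchanged
-- (b = ω s) or appends b (b ≠ ω s).  Hence if the last letters of a
-- transient vector u and a binary vector w differ exactly in coordinate i,
-- then u ∘ w is u with w_i appended to its i-th component: an arc of D_f
-- whose target has last-letter vector w.  Conversely every arc u → v of
-- D_f(x) is recovered as u ∘ ω(v), and ω(u), ω(v) are adjacent in the cube.
-- So W and P translate arcs into cube edges and back, they are mutually
-- inverse, and since λ = f ∘ ω the two counts agree.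

open import Defs
open import Data.Bool using (Bool)
open import Data.Bool.Properties using () renaming (_≟_ to _≟B_)
open import Data.Nat using (ℕ; suc)
open import Data.Fin using (Fin; zero; suc) renaming (_≟_ to _≟F_)
open import Data.List using (List; []; _∷_; _++_)
import Data.List as List
open import Data.List.Properties using (++-identityʳ)
open import Data.List.NonEmpty using (List⁺; _∷_; [_]; _∷⁺_; _⁺∷ʳ_; _⁺++_; toList; head)
open import Data.List.Relation.Unary.Linked using (Linked; []; [-]; _∷_)
import Data.List.Relation.Unary.Linked as Linked
import Data.List.Relation.Unary.All as LAll
import Data.List.Relation.Binary.Pointwise as ListPW
open import Data.List.Relation.Binary.Prefix.Heterogeneous using (Prefix; []; _∷_; _++ᵖ_)
import Data.List.Relation.Binary.Prefix.Heterogeneous.Properties as Prefix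
open import Data.Vec using ([]; _∷_; lookup; updateAt)
open import Data.Vec.Properties
  using (lookup-map; lookup-zipWith; lookup∘updateAt; lookup∘updateAt′; map-∘; map-id)
open import Data.Vec.Relation.Unary.All using ([]; _∷_)
open import Data.Vec.Relation.Unary.All.Properties using (lookup⁺)
open import Data.Vec.Relation.Binary.Pointwise.Inductive using ([]; _∷_)
import Data.Vec.Relation.Binary.Pointwise.Inductive as PW
open import Data.Vec.Relation.Binary.Pointwise.Extensional using (ext; Pointwise-≡⇒≡)
open import Data.Product using (_×_; _,_)
open import Data.Empty using (⊥-elim)
open import Function using (_∘_)
open import Relation.Binary.Core using (Rel)
open import Relation.Binary.Definitions using (Reflexive; Transitive)
open import Relation.Binary.PropositionalEquality
  using (_≡_; _≢_; refl; sym; trans; cong; cong₂; subst; ≢-sym; module ≡-Reasoning)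
open import Relation.Nullary using (yes; no)

open ≡-Reasoning

private
  variable
    n : ℕ
    A C : Set

keep-++ : ∀ p xs ys → keep p (xs ++ ys) ≡ keep p xs ++ keep (lastFrom p xs) ys
keep-++ p []       ys = refl
keep-++ p (x ∷ xs) ys with x ≟B p
... | yes _ = keep-++ x xs ys
... | no  _ = cong (x ∷_) (keep-++ x xs ys)

keep-linked : ∀ p xs → Linked _≢_ (p ∷ xs) → keep p xs ≡ xs
keep-linked p []       _          = refl
keep-linked p (x ∷ xs) (p≢x ∷ l) with x ≟B p
... | yes x≡p = ⊥-elim (p≢x (sym x≡p))
... | no  _   = cong (x ∷_) (keep-linked x xs l)

keep-[-]-≡ : ∀ b → keep b (b ∷ []) ≡ []
keep-[-]-≡ b with b ≟B b
... | yes _   = refl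
... | no  b≢b = ⊥-elim (b≢b refl)

keep-[-]-≢ : ∀ {p b} → b ≢ p → keep p (b ∷ []) ≡ b ∷ []
keep-[-]-≢ {p} {b} b≢p with b ≟B p
... | yes b≡p = ⊥-elim (b≢p b≡p)
... | no  _   = refl

∘T-[-] : ∀ {s} b → IsTransient s → s ∘T [ b ] ≡ s ⁺++ keep (ω s) (b ∷ [])
∘T-[-] {a ∷ as} b t = cong (a ∷_) (begin
  keep a (as ++ b ∷ [])                      ≡⟨ keep-++ a as (b ∷ []) ⟩
  keep a as ++ keep (lastFrom a as) (b ∷ [])
    ≡⟨ cong (_++ keep (lastFrom a as) (b ∷ [])) (keep-linked a as t) ⟩
  as ++ keep (lastFrom a as) (b ∷ [])        ∎)

∘T-ω : ∀ {s} → IsTransient s → s ∘T [ ω s ] ≡ s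
∘T-ω {a ∷ as} t = begin
  (a ∷ as) ∘T [ ω (a ∷ as) ]                           ≡⟨ ∘T-[-] (ω (a ∷ as)) t ⟩
  (a ∷ as) ⁺++ keep (lastFrom a as) (lastFrom a as ∷ [])
    ≡⟨ cong ((a ∷ as) ⁺++_) (keep-[-]-≡ (lastFrom a as)) ⟩
  a ∷ (as ++ [])                                       ≡⟨ cong (a ∷_) (++-identityʳ as) ⟩
  a ∷ as                                               ∎

∘T-≢ω : ∀ {s b} → IsTransient s → ω s ≢ b → s ∘T [ b ] ≡ s ⁺∷ʳ b
∘T-≢ω {s} {b} t ωs≢b = trans (∘T-[-] b t) (cong (s ⁺++_) (keep-[-]-≢ (≢-sym ωs≢b)))

lastFrom-++-[-] : ∀ (a : A) as b → lastFrom a (as ++ b ∷ []) ≡ b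
lastFrom-++-[-] a []       b = refl
lastFrom-++-[-] a (x ∷ as) b = lastFrom-++-[-] x as b

ω-⁺∷ʳ : ∀ s b → ω (s ⁺∷ʳ b) ≡ b
ω-⁺∷ʳ (a ∷ as) = lastFrom-++-[-] a as

module _ {ℓ} {R : Rel A ℓ} where

  linked-++-[-] : ∀ {a as b} → Linked R (a ∷ as) → R (lastFrom a as) b →
                  Linked R (a ∷ as ++ b ∷ [])
  linked-++-[-] {as = []}     [-]      r = r ∷ [-]
  linked-++-[-] {as = _ ∷ _} (r′ ∷ l) r = r′ ∷ linked-++-[-] l r

  linked-++-[-]⁻ : ∀ {a} as {b} → Linked R (a ∷ as ++ b ∷ []) → R (lastFrom a as) b
  linked-++-[-]⁻ []       (r ∷ _) = r
  linked-++-[-]⁻ (_ ∷ as) (_ ∷ l) = linked-++-[-]⁻ as l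

  prefix-linked : ∀ {xs ys} → Prefix _≡_ xs ys → Linked R ys → Linked R xs
  prefix-linked []                   _       = []
  prefix-linked (refl ∷ [])          _       = [-]
  prefix-linked (refl ∷ refl ∷ pre) (r ∷ l) = r ∷ prefix-linked (refl ∷ pre) l

  linked⇒all-lastFrom : Reflexive R → Transitive R → ∀ {a as} →
                        Linked R (a ∷ as) → LAll.All (λ v → R v (lastFrom a as)) (a ∷ as)
  linked⇒all-lastFrom refl′ _      [-]     = refl′ LAll.∷ LAll.[]
  linked⇒all-lastFrom refl′ trans′ (r ∷ l) with linked⇒all-lastFrom refl′ trans′ l
  ... | r′ LAll.∷ rs = trans′ r r′ LAll.∷ r′ LAll.∷ rs

⁺∷ʳ-transient : ∀ {s b} → IsTransient s → ω s ≢ b → IsTransient (s ⁺∷ʳ b)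
⁺∷ʳ-transient = linked-++-[-]

⁺∷ʳ-transient⁻ : ∀ s {b} → IsTransient (s ⁺∷ʳ b) → ω s ≢ b
⁺∷ʳ-transient⁻ (a ∷ as) = linked-++-[-]⁻ as

∘T-transient : ∀ {s} b → IsTransient s → IsTransient (s ∘T [ b ])
∘T-transient {s} b t with ω s ≟B b
... | yes refl  = subst IsTransient (sym (∘T-ω t)) t
... | no  ωs≢b = subst IsTransient (sym (∘T-≢ω t ωs≢b)) (⁺∷ʳ-transient t ωs≢b)

ω-∘T : ∀ {s} b → IsTransient s → ω (s ∘T [ b ]) ≡ b
ω-∘T {s} b t with ω s ≟B b
... | yes refl  = cong ω (∘T-ω t)
... | no  ωs≢b = trans (cong ω (∘T-≢ω t ωs≢b)) (ω-⁺∷ʳ s b)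

_≼_ : Rel Word _
s ≼ t = Prefix _≡_ (toList s) (toList t)

≼-refl : Reflexive _≼_
≼-refl = Prefix.fromPointwise (ListPW.refl refl)

≼-trans : Transitive _≼_
≼-trans = Prefix.trans trans

≼-⁺∷ʳ : ∀ s b → s ≼ (s ⁺∷ʳ b)
≼-⁺∷ʳ s b = ≼-refl ++ᵖ (b ∷ [])

IsPrefixV-refl : Reflexive (IsPrefixV {n})
IsPrefixV-refl = PW.refl ≼-refl

IsPrefixV-trans : Transitive (IsPrefixV {n})
IsPrefixV-trans = PW.trans ≼-trans

prefix-transient : ∀ {u x : TVec n} → IsPrefixV u x → IsTransientVec x → IsTransientVec u
prefix-transient []           []       = []
prefix-transient (pre ∷ pres) (t ∷ ts) = prefix-linked pre t ∷ prefix-transient pres ts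

embed-transient : (w : BVec n) → IsTransientVec (embed w)
embed-transient []      = []
embed-transient (_ ∷ w) = [-] ∷ embed-transient w

ωV-embed : (w : BVec n) → ωV (embed w) ≡ w
ωV-embed w = trans (sym (map-∘ ω [_] w)) (map-id w)

αV-embed : (w : BVec n) → αV (embed w) ≡ w
αV-embed w = trans (sym (map-∘ α [_] w)) (map-id w)

αV-∘V : (u v : TVec n) → αV (u ∘V v) ≡ αV u
αV-∘V []      []      = refl
αV-∘V (s ∷ u) (t ∷ v) = cong (α s ∷_) (αV-∘V u v)

αV-foldl : ∀ (acc : TVec n) vs → αV (List.foldl _∘V_ acc vs) ≡ αV acc
αV-foldl acc []       = refl
αV-foldl acc (v ∷ vs) = trans (αV-foldl (acc ∘V v) vs) (αV-∘V acc v)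

αV-compose : (W : List⁺ (BVec n)) → αV (compose W) ≡ head W
αV-compose (w ∷ ws) = trans (αV-foldl (embed w) (List.map embed ws)) (αV-embed w)

∘V-transient : ∀ {u : TVec n} w → IsTransientVec u → IsTransientVec (u ∘V embed w)
∘V-transient []      []       = []
∘V-transient (b ∷ w) (t ∷ ts) = ∘T-transient b t ∷ ∘V-transient w ts

ωV-∘V : ∀ {u : TVec n} w → IsTransientVec u → ωV (u ∘V embed w) ≡ w
ωV-∘V []      []       = refl
ωV-∘V (b ∷ w) (t ∷ ts) = cong₂ _∷_ (ω-∘T b t) (ωV-∘V w ts)

AdjacentAt : Fin n → BVec n → BVec n → Set
AdjacentAt i u v = lookup u i ≢ lookup v i × (∀ j → j ≢ i → lookup u j ≡ lookup v j)

lookup-ωV : (u : TVec n) (i : Fin n) → lookup (ωV u) i ≡ ω (lookup u i)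
lookup-ωV u i = lookup-map i ω u

lookup-∘V-embed : (u : TVec n) (w : BVec n) (i : Fin n) →
                  lookup (u ∘V embed w) i ≡ lookup u i ∘T [ lookup w i ]
lookup-∘V-embed u w i =
  trans (lookup-zipWith _∘T_ i u (embed w)) (cong (lookup u i ∘T_) (lookup-map i [_] w))

∘V-embed-adjacentAt : ∀ {u : TVec n} {w} i → IsTransientVec u → AdjacentAt i (ωV u) w →
                      u ∘V embed w ≡ updateAt u i (_⁺∷ʳ lookup w i)
∘V-embed-adjacentAt {u = u} {w} i tu (ωuᵢ≢wᵢ , ωuⱼ≡wⱼ) = Pointwise-≡⇒≡ (ext component)
  where
  component : ∀ j → lookup (u ∘V embed w) j ≡ lookup (updateAt u i (_⁺∷ʳ lookup w i)) j
  component j with j ≟F i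
  ... | yes refl = begin
    lookup (u ∘V embed w) j        ≡⟨ lookup-∘V-embed u w j ⟩
    lookup u j ∘T [ lookup w j ]
      ≡⟨ ∘T-≢ω (lookup⁺ tu j) (ωuᵢ≢wᵢ ∘ trans (lookup-ωV u j)) ⟩
    lookup u j ⁺∷ʳ lookup w j      ≡⟨ lookup∘updateAt j u ⟨
    lookup (updateAt u j _) j      ∎
  ... | no j≢i = begin
    lookup (u ∘V embed w) j        ≡⟨ lookup-∘V-embed u w j ⟩
    lookup u j ∘T [ lookup w j ]
      ≡⟨ cong (λ b → lookup u j ∘T [ b ]) (trans (sym (ωuⱼ≡wⱼ j j≢i)) (lookup-ωV u j)) ⟩
    lookup u j ∘T [ ω (lookup u j) ] ≡⟨ ∘T-ω (lookup⁺ tu j) ⟩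
    lookup u j                     ≡⟨ lookup∘updateAt′ j i j≢i u ⟨
    lookup (updateAt u i _) j      ∎

lookup-ωV-updateAt : (u : TVec n) (i : Fin n) (b : Bool) →
                     lookup (ωV (updateAt u i (_⁺∷ʳ b))) i ≡ b
lookup-ωV-updateAt u i b = begin
  lookup (ωV (updateAt u i (_⁺∷ʳ b))) i ≡⟨ lookup-ωV (updateAt u i _) i ⟩
  ω (lookup (updateAt u i (_⁺∷ʳ b)) i)  ≡⟨ cong ω (lookup∘updateAt i u) ⟩
  ω (lookup u i ⁺∷ʳ b)                  ≡⟨ ω-⁺∷ʳ (lookup u i) b ⟩
  b                                     ∎

ωV-updateAt-adjacentAt : ∀ (u : TVec n) i b → IsTransientVec (updateAt u i (_⁺∷ʳ b)) →
                         AdjacentAt i (ωV u) (ωV (updateAt u i (_⁺∷ʳ b)))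
ωV-updateAt-adjacentAt u i b tv =
  (λ e → ωuᵢ≢b (trans e (lookup-ωV-updateAt u i b))) , unchanged
  where
  ωuᵢ≢b : lookup (ωV u) i ≢ b
  ωuᵢ≢b e = ⁺∷ʳ-transient⁻ (lookup u i)
    (subst IsTransient (lookup∘updateAt i u) (lookup⁺ tv i)) (trans (sym (lookup-ωV u i)) e)
  unchanged : ∀ j → j ≢ i → lookup (ωV u) j ≡ lookup (ωV (updateAt u i (_⁺∷ʳ b))) j
  unchanged j j≢i = begin
    lookup (ωV u) j                   ≡⟨ lookup-ωV u j ⟩
    ω (lookup u j)                    ≡⟨ cong ω (lookup∘updateAt′ j i j≢i u) ⟨
    ω (lookup (updateAt u i _) j)     ≡⟨ lookup-ωV (updateAt u i _) j ⟨
    lookup (ωV (updateAt u i _)) j    ∎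

adjacent⇒arc : ∀ {u : TVec n} {w} → IsTransientVec u → Adjacent (ωV u) w →
               Arc u (u ∘V embed w)
adjacent⇒arc {w = w} tu (i , adj) = i , lookup w i , ∘V-embed-adjacentAt i tu adj

arc⇒adjacent : ∀ {u v : TVec n} → IsTransientVec v → Arc u v → Adjacent (ωV u) (ωV v)
arc⇒adjacent {u = u} tv (i , b , refl) = i , ωV-updateAt-adjacentAt u i b tv

arc-∘V-ωV : ∀ {u v : TVec n} → IsTransientVec u → IsTransientVec v → Arc u v →
            u ∘V embed (ωV v) ≡ v
arc-∘V-ωV {u = u} tu tv (i , b , refl) = begin
  u ∘V embed (ωV v)
    ≡⟨ ∘V-embed-adjacentAt i tu (ωV-updateAt-adjacentAt u i b tv) ⟩
  updateAt u i (_⁺∷ʳ lookup (ωV v) i)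
    ≡⟨ cong (λ c → updateAt u i (_⁺∷ʳ c)) (lookup-ωV-updateAt u i b) ⟩
  v
    ∎
  where v = updateAt u i (_⁺∷ʳ b)

updateAt-⁺∷ʳ-prefix : ∀ (u : TVec n) i b → IsPrefixV u (updateAt u i (_⁺∷ʳ b))
updateAt-⁺∷ʳ-prefix (s ∷ u) zero    b = ≼-⁺∷ʳ s b ∷ IsPrefixV-refl
updateAt-⁺∷ʳ-prefix (s ∷ u) (suc i) b = ≼-refl ∷ updateAt-⁺∷ʳ-prefix u i b

arc⇒prefix : ∀ {u v : TVec n} → Arc u v → IsPrefixV u v
arc⇒prefix {u = u} (i , b , refl) = updateAt-⁺∷ʳ-prefix u i b

arcs⇒prefixes-of-last : ∀ {P : List⁺ (TVec n)} → Consec Arc P →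
                        LAll.All (λ v → IsPrefixV v (lastᴸ P)) (toList P)
arcs⇒prefixes-of-last arcs =
  linked⇒all-lastFrom IsPrefixV-refl IsPrefixV-trans (Linked.map arc⇒prefix arcs)

arcs⇒pathFromTo : ∀ {x : TVec n} {P} → Consec Arc P → head P ≡ embed (αV x) → lastᴸ P ≡ x →
                  IsPathFromTo x P
arcs⇒pathFromTo arcs hd refl = (arcs⇒prefixes-of-last arcs , arcs) , hd , refl

path-transient : ∀ {x : TVec n} {P} → IsTransientVec x → IsPathD x P →
                 LAll.All IsTransientVec (toList P)
path-transient tx (prefixes , _) = LAll.map (λ pre → prefix-transient pre tx) prefixes

arcs⇒walk : ∀ {us : List (TVec n)} → LAll.All IsTransientVec us → Linked Arc us →
            Linked Adjacent (List.map ωV us)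
arcs⇒walk _                       []         = []
arcs⇒walk _                       [-]        = [-]
arcs⇒walk (_ LAll.∷ tv LAll.∷ ts) (arc ∷ arcs) =
  arc⇒adjacent tv arc ∷ arcs⇒walk (tv LAll.∷ ts) arcs

Wof-walk : ∀ {x : TVec n} {P} → IsTransientVec x → IsPathFromTo x P → IsWalk (Wof P)
Wof-walk tx (path@(_ , arcs) , _) = arcs⇒walk (path-transient tx path) arcs

head-scanComp : ∀ (acc : TVec n) ws → head (scanComp acc ws) ≡ acc
head-scanComp acc []      = refl
head-scanComp acc (_ ∷ _) = refl

lastᴸ-scanComp : ∀ (acc : TVec n) ws →
                 lastᴸ (scanComp acc ws) ≡ List.foldl _∘V_ acc (List.map embed ws)
lastᴸ-scanComp acc []       = refl
lastᴸ-scanComp acc (w ∷ ws) = lastᴸ-scanComp (acc ∘V embed w) ws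

Wof-scanComp : ∀ {acc : TVec n} ws → IsTransientVec acc → Wof (scanComp acc ws) ≡ ωV acc ∷ ws
Wof-scanComp                []       _  = refl
Wof-scanComp {acc = acc} (w ∷ ws) tu = cong (ωV acc ∷⁺_) (begin
  Wof (scanComp (acc ∘V embed w) ws) ≡⟨ Wof-scanComp ws (∘V-transient w tu) ⟩
  ωV (acc ∘V embed w) ∷ ws           ≡⟨ cong (_∷ ws) (ωV-∘V w tu) ⟩
  w ∷ ws                             ∎)

scanComp-arcs : ∀ {acc : TVec n} {w} ws → IsTransientVec acc → ωV acc ≡ w →
                Linked Adjacent (w ∷ ws) → Consec Arc (scanComp acc ws)
scanComp-arcs            []        _  _    _            = [-]
scanComp-arcs {acc = acc} (w ∷ ws) tu refl (adj ∷ walk) =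
  subst (Arc acc) (sym (head-scanComp (acc ∘V embed w) ws)) (adjacent⇒arc tu adj)
  ∷ scanComp-arcs ws (∘V-transient w tu) (ωV-∘V w tu) walk

scanComp-ωV-arcs : ∀ {u : TVec n} us → LAll.All IsTransientVec (u ∷ us) →
                   Linked Arc (u ∷ us) → scanComp u (List.map ωV us) ≡ u ∷ us
scanComp-ωV-arcs          []       _                          _            = refl
scanComp-ωV-arcs {u = u} (v ∷ vs) (tu LAll.∷ tv LAll.∷ ts) (arc ∷ arcs) = begin
  u ∷⁺ scanComp (u ∘V embed (ωV v)) (List.map ωV vs)
    ≡⟨ cong (λ z → u ∷⁺ scanComp z (List.map ωV vs)) (arc-∘V-ωV tu tv arc) ⟩
  u ∷⁺ scanComp v (List.map ωV vs)
    ≡⟨ cong (u ∷⁺_) (scanComp-ωV-arcs vs (tv LAll.∷ ts) arcs) ⟩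
  u ∷ v ∷ vs
    ∎

Wof-Pof : (W : List⁺ (BVec n)) → Wof (Pof W) ≡ W
Wof-Pof (w ∷ ws) = trans (Wof-scanComp ws (embed-transient w)) (cong (_∷ ws) (ωV-embed w))

Pof-pathFromTo : ∀ {x : TVec n} {W} → IsWalk W → x ≡ compose W → IsPathFromTo x (Pof W)
Pof-pathFromTo {W = w ∷ ws} walk refl = arcs⇒pathFromTo
  (scanComp-arcs ws (embed-transient w) (ωV-embed w) walk)
  (trans (head-scanComp (embed w) ws) (cong embed (sym (αV-compose (w ∷ ws)))))
  (lastᴸ-scanComp (embed w) ws)

Pof-Wof : ∀ {x : TVec n} {P} → IsTransientVec x → IsPathFromTo x P → Pof (Wof P) ≡ P
Pof-Wof {x = x} {P = p ∷ ps} tx (path@(_ , arcs) , refl , _) = begin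
  scanComp (embed (ωV (embed (αV x)))) (List.map ωV ps)
    ≡⟨ cong (λ z → scanComp (embed z) (List.map ωV ps)) (ωV-embed (αV x)) ⟩
  scanComp (embed (αV x)) (List.map ωV ps)
    ≡⟨ scanComp-ωV-arcs ps (path-transient tx path) arcs ⟩
  embed (αV x) ∷ ps
    ∎

sameFrom-map : ∀ (g : C → Bool) (h : A → C) a as →
               sameFrom (g ∘ h) a as ≡ sameFrom g (h a) (List.map h as)
sameFrom-map g h a []       = refl
sameFrom-map g h a (b ∷ bs) with g (h a) ≟B g (h b)
... | yes _ = cong suc (sameFrom-map g h b bs)
... | no  _ = sameFrom-map g h b bs

cP≡cW-Wof : ∀ (f : BVec n → Bool) P → cP f P ≡ cW f (Wof P)
cP≡cW-Wof f (p ∷ ps) = sameFrom-map f ωV p ps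

theorem2 : (n : ℕ) (f : BVec n → Bool) →
    ((x : TVec n) → IsTransientVec x →
      ((P : List⁺ (TVec n)) → IsPathFromTo x P →
          IsWalk (Wof P) × cP f P ≡ cW f (Wof P))
      × ((W : List⁺ (BVec n)) → IsWalk W → x ≡ compose W →
          IsPathFromTo x (Pof W) × cW f W ≡ cP f (Pof W))
      × ((P : List⁺ (TVec n)) → IsPathFromTo x P → Pof (Wof P) ≡ P))
    × ((W : List⁺ (BVec n)) → IsWalk W → Wof (Pof W) ≡ W)
theorem2 n f =
  (λ x tx →
      (λ P path → Wof-walk tx path , cP≡cW-Wof f P)
    , (λ W walk x≡W → Pof-pathFromTo walk x≡W , cW≡cP-Pof W)
    , (λ P → Pof-Wof tx))
  , λ W _ → Wof-Pof W
  where
  cW≡cP-Pof : ∀ W → cW f W ≡ cP f (Pof W)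
  cW≡cP-Pof W = sym (trans (cP≡cW-Wof f (Pof W)) (cong (cW f) (Wof-Pof W)))
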